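{- (1) If $P \sqsubseteq_{\mathrm{pmay}} Q$ then $P \mathrel{\overline{\sqsubseteq}_{\mathrm{pmay}}} Q$. (2) If $P \sqsubseteq_{\mathrm{pmust}} Q$ then $P \mathrel{\overline{\sqsubseteq}_{\mathrm{pmust}}} Q$.
   Context: $P,Q$ are processes of $\mathsf{pCSP}$ (finite probabilistic CSP with prefixing, internal choice $\sqcap$, external choice $\Box$, probabilistic choice $\oplus_p$, parallel $\mid_A$), interpreted as distributions $[\![P]\!]$ over states of a probabilistic labelled transition system. Tests are $\mathsf{pCSP}$ terms that may contain $\omega.P$ for a fresh success action $\omega$. State-based results: $\mathcal{V}(s)=\{1\}$ if $s\xrightarrow{\omega}$; $\mathcal{V}(s)=\bigcup\{\mathcal{V}(\Delta)\mid s\xrightarrow{\alpha}\Delta\}$ if $s$ cannot do $\omega$ but has some transition; $\{0\}$ if $s$ has no transition. Action-based results: $\overline{\mathcal{V}}(s)=\bigcup\{\overline{\mathcal{V}}(\Delta)\mid s\xrightarrow{\alpha}\Delta,\ \alpha\neq\omega\}\cup\{1\mid s\xrightarrow{\omega}\}$ if $s$ has some transition, and $\{0\}$ otherwise. Both extend to distributions by $\mathcal{V}(\Delta)=\{\sum_s\Delta(s)f(s)\mid f(s)\in\mathcal{V}(s)\}$ (likewise for $\overline{\mathcal{V}}$). $\mathcal{A}(T,P)=\mathcal{V}([\![T\mid_{\mathsf{Act}}P]\!])$ and $\overline{\mathcal{A}}(T,P)=\overline{\mathcal{V}}([\![T\mid_{\mathsf{Act}}P]\!])$. $P\sqsubseteq_{\mathrm{pmay}}Q$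 (resp. $\sqsubseteq_{\mathrm{pmust}}$) iff $\mathcal{A}(T,P)\le_{\mathrm{Ho}}\mathcal{A}(T,Q)$ (resp. $\le_{\mathrm{Sm}}$) for all tests $T$; $\overline{\sqsubseteq}_{\mathrm{pmay}}$ and $\overline{\sqsubseteq}_{\mathrm{pmust}}$ are defined the same way using $\overline{\mathcal{A}}$. Here $X\le_{\mathrm{Ho}}Y$ iff every $x\in X$ has some $y\in Y$ with $x\le y$, and $X\le_{\mathrm{Sm}}Y$ iff every $y\in Y$ has some $x\in X$ with $x\le y$. -}

module Defs where

open import Data.Nat using (ℕ)
open import Data.Fin using (Fin)
open import Data.Fin.Subset using (Subset; _∈_; _∉_)
open import Data.Rational using (ℚ; 0ℚ; 1ℚ; _+_; _*_; _-_; _<_; _≤_)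
open import Data.List using (List; []; _∷_; _++_; map; concatMap)
open import Data.List.Relation.Unary.All using (All)
open import Data.Product using (_×_; _,_; Σ; ∃; ∃-syntax)
open import Relation.Binary.PropositionalEquality using (_≡_; _≢_)
open import Relation.Nullary using (¬_)

-- Throughout, the set of visible actions Act is Fin n (a finite set), the
-- parameter n being arbitrary.  Synchronisation sets A ⊆ Act are Subset n.

module _ {n : ℕ} where

  -- prefixes: visible actions a ∈ Act, or the success action ω (tests only)
  data Pfx : Set where
    act : Fin n → Pfx
    ω   : Pfx

  data Label : Set where
    τ   : Label
    lω  : Label
    lac : Fin n → Label

  pfxLabel : Pfx → Label
  pfxLabel (act a) = lac a
  pfxLabel ω = lω

  -- pCSP terms (possibly containing ω, i.e. tests).  Probabilities of
  -- ⊕ lie strictly between 0 and 1 (proofs are irrelevant, so syntactic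
  -- equality of terms ignores them).
  data Proc : Set where
    nil   : Proc
    _∙_   : Pfx → Proc → Proc
    _⊓_   : Proc → Proc → Proc
    _□_   : Proc → Proc → Proc
    ⊕[_,_,_] : (p : ℚ) → .(0ℚ < p) → .(p < 1ℚ) → Proc → Proc → Proc
    par   : Proc → Subset n → Proc → Proc

  data ωFree : Proc → Set where
    nil : ωFree nil
    pre : ∀ {a P} → ωFree P → ωFree (act a ∙ P)
    int : ∀ {P Q} → ωFree P → ωFree Q → ωFree (P ⊓ Q)
    ext : ∀ {P Q} → ωFree P → ωFree Q → ωFree (P □ Q)
    pch : ∀ {p P Q} .{h₁ : 0ℚ < p} .{h₂ : p < 1ℚ} → ωFree P → ωFree Q →
          ωFree (⊕[ p , h₁ , h₂ ] P Q)
    prl : ∀ {P A Q} → ωFree P → ωFree Q → ωFree (par P A Q)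

  -- finite-support (sub)distributions over states, as weighted lists;
  -- a state may occur several times, its mass being the sum of its weights
  Dist : Set
  Dist = List (ℚ × Proc)

  point : Proc → Dist
  point s = (1ℚ , s) ∷ []

  scale : ℚ → Dist → Dist
  scale p = map (λ { (q , s) → (p * q , s) })

  pmix : ℚ → Dist → Dist → Dist
  pmix p Δ Θ = scale p Δ ++ scale (1ℚ - p) Θ

  lift₂ : (Proc → Proc → Proc) → Dist → Dist → Dist
  lift₂ op Δ Θ = concatMap (λ { (p , s) → map (λ { (q , t) → (p * q , op s t) }) Θ }) Δ

  ⟦_⟧ : Proc → Dist
  ⟦ nil ⟧ = point nil
  ⟦ π ∙ P ⟧ = point (π ∙ P)
  ⟦ P ⊓ Q ⟧ = point (P ⊓ Q)
  ⟦ P □ Q ⟧ = lift₂ _□_ ⟦ P ⟧ ⟦ Q ⟧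
  ⟦ ⊕[ p , _ , _ ] P Q ⟧ = pmix p ⟦ P ⟧ ⟦ Q ⟧
  ⟦ par P A Q ⟧ = lift₂ (λ s t → par s A t) ⟦ P ⟧ ⟦ Q ⟧

  -- α ∉ A (τ and ω are never synchronised)
  data NotSync (A : Subset n) : Label → Set where
    τ  : NotSync A τ
    ω  : NotSync A lω
    ac : ∀ {a} → a ∉ A → NotSync A (lac a)

  data _—[_]→_ : Proc → Label → Dist → Set where
    pre  : ∀ {π P} → (π ∙ P) —[ pfxLabel π ]→ ⟦ P ⟧
    intL : ∀ {P Q} → (P ⊓ Q) —[ τ ]→ ⟦ P ⟧
    intR : ∀ {P Q} → (P ⊓ Q) —[ τ ]→ ⟦ Q ⟧
    extL : ∀ {s₁ s₂ α Δ} → α ≢ τ → s₁ —[ α ]→ Δ → (s₁ □ s₂) —[ α ]→ Δ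
    extR : ∀ {s₁ s₂ α Δ} → α ≢ τ → s₂ —[ α ]→ Δ → (s₁ □ s₂) —[ α ]→ Δ
    extτL : ∀ {s₁ s₂ Δ} → s₁ —[ τ ]→ Δ → (s₁ □ s₂) —[ τ ]→ lift₂ _□_ Δ (point s₂)
    extτR : ∀ {s₁ s₂ Δ} → s₂ —[ τ ]→ Δ → (s₁ □ s₂) —[ τ ]→ lift₂ _□_ (point s₁) Δ
    parL : ∀ {s₁ s₂ A α Δ} → NotSync A α → s₁ —[ α ]→ Δ →
           par s₁ A s₂ —[ α ]→ lift₂ (λ s t → par s A t) Δ (point s₂)
    parR : ∀ {s₁ s₂ A α Δ} → NotSync A α → s₂ —[ α ]→ Δ →
           par s₁ A s₂ —[ α ]→ lift₂ (λ s t → par s A t) (point s₁) Δ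
    sync : ∀ {s₁ s₂ A a Δ₁ Δ₂} → a ∈ A → s₁ —[ lac a ]→ Δ₁ → s₂ —[ lac a ]→ Δ₂ →
           par s₁ A s₂ —[ τ ]→ lift₂ (λ s t → par s A t) Δ₁ Δ₂

  wsum : Dist → (Proc → ℚ) → ℚ
  wsum [] f = 0ℚ
  wsum ((p , s) ∷ Δ) f = p * f s + wsum Δ f

  Stuck : Proc → Set
  Stuck s = ∀ α Δ → ¬ (s —[ α ]→ Δ)

  -- state-based results: V s x means x ∈ 𝒱(s); VD Δ x means x ∈ 𝒱(Δ)
  mutual
    data V : Proc → ℚ → Set where
      succ  : ∀ {s Δ} → s —[ lω ]→ Δ → V s 1ℚ
      step  : ∀ {s α Δ x} → ¬ (∃[ Θ ] (s —[ lω ]→ Θ)) → s —[ α ]→ Δ → VD Δ x → V s x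
      stuck : ∀ {s} → Stuck s → V s 0ℚ

    data VD (Δ : Dist) (x : ℚ) : Set where
      mk : (f : Proc → ℚ) → All (λ ps → V (Data.Product.proj₂ ps) (f (Data.Product.proj₂ ps))) Δ →
           x ≡ wsum Δ f → VD Δ x

  mutual
    data V̄ : Proc → ℚ → Set where
      succ  : ∀ {s Δ} → s —[ lω ]→ Δ → V̄ s 1ℚ
      step  : ∀ {s α Δ x} → s —[ α ]→ Δ → α ≢ lω → V̄D Δ x → V̄ s x
      stuck : ∀ {s} → Stuck s → V̄ s 0ℚ

    data V̄D (Δ : Dist) (x : ℚ) : Set where
      mk : (f : Proc → ℚ) → All (λ ps → V̄ (Data.Product.proj₂ ps) (f (Data.Product.proj₂ ps))) Δ →
           x ≡ wsum Δ f → V̄D Δ x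

  ActAll : Subset n
  ActAll = Data.Fin.Subset.⊤

  𝒜 : Proc → Proc → ℚ → Set
  𝒜 T P = VD ⟦ par T ActAll P ⟧

  𝒜̄ : Proc → Proc → ℚ → Set
  𝒜̄ T P = V̄D ⟦ par T ActAll P ⟧

  _≤Ho_ : (ℚ → Set) → (ℚ → Set) → Set
  X ≤Ho Y = ∀ x → X x → ∃[ y ] (Y y × x ≤ y)

  _≤Sm_ : (ℚ → Set) → (ℚ → Set) → Set
  X ≤Sm Y = ∀ y → Y y → ∃[ x ] (X x × x ≤ y)

  -- testing preorders (tests T range over all terms, which may contain ω)
  _⊑pmay_ : Proc → Proc → Set
  P ⊑pmay Q = ∀ T → 𝒜 T P ≤Ho 𝒜 T Q

  _⊑pmust_ : Proc → Proc → Set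
  P ⊑pmust Q = ∀ T → 𝒜 T P ≤Sm 𝒜 T Q

  _⊑̄pmay_ : Proc → Proc → Set
  P ⊑̄pmay Q = ∀ T → 𝒜̄ T P ≤Ho 𝒜̄ T Q

  _⊑̄pmust_ : Proc → Proc → Set
  P ⊑̄pmust Q = ∀ T → 𝒜̄ T P ≤Sm 𝒜̄ T Q

{-# OPTIONS --safe #-}
-- Replace every ω-prefix ω.R of a test by the internal choice ω.R ⊓ ω.R. In the
-- resulting test no state can perform ω itself; instead each ω-transition of the
-- original becomes a τ-step to a state that can. The state-based semantics of a
-- state without ω is the union over all its transitions, so for the translated
-- test it counts the delayed success alongside the other moves, exactly as the
-- action-based semantics does for the original: 𝒜 (delayω T) P = 𝒜̄ T P for every
-- ω-free P. Each action-based comparison is therefore a state-based one.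
module Submission where

open import Defs
open import Data.Nat using (ℕ)
open import Data.Product using (_×_; _,_; proj₂; map₂; ∃-syntax)
open import Data.Rational using (1ℚ; _+_; _*_; _-_)
open import Data.List using ([]; _∷_; _++_; map)
open import Data.List.Properties using (map-++)
open import Data.List.Relation.Unary.All using (All; []; _∷_)
open import Data.Empty using (⊥-elim)
open import Relation.Nullary using (¬_)
open import Relation.Binary.PropositionalEquality

module _ {n : ℕ} where

  mapD : (Proc {n} → Proc {n}) → Dist {n} → Dist {n}
  mapD f = map (map₂ f)

  lift₂-mapD : ∀ (op : Proc {n} → Proc {n} → Proc {n}) f → (∀ s t → f (op s t) ≡ op (f s) (f t)) →
               ∀ Δ Θ → lift₂ op (mapD f Δ) (mapD f Θ) ≡ mapD f (lift₂ op Δ Θ)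
  lift₂-mapD op f hom [] Θ = refl
  lift₂-mapD op f hom ((p , s) ∷ Δ) Θ =
    trans (cong₂ _++_ (row Θ) (lift₂-mapD op f hom Δ Θ))
          (sym (map-++ (map₂ f) (map (λ { (q , t) → (p * q , op s t) }) Θ) (lift₂ op Δ Θ)))
    where
    row : ∀ Θ → map (λ { (q , t) → (p * q , op (f s) t) }) (mapD f Θ)
              ≡ mapD f (map (λ { (q , t) → (p * q , op s t) }) Θ)
    row [] = refl
    row ((q , t) ∷ Θ) = cong₂ _∷_ (cong (p * q ,_) (sym (hom s t))) (row Θ)

  scale-mapD : ∀ f p (Δ : Dist {n}) → scale p (mapD f Δ) ≡ mapD f (scale p Δ)
  scale-mapD f p [] = refl
  scale-mapD f p ((q , s) ∷ Δ) = cong (_ ∷_) (scale-mapD f p Δ)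

  pmix-mapD : ∀ f p (Δ Θ : Dist {n}) → pmix p (mapD f Δ) (mapD f Θ) ≡ mapD f (pmix p Δ Θ)
  pmix-mapD f p Δ Θ =
    trans (cong₂ _++_ (scale-mapD f p Δ) (scale-mapD f (1ℚ - p) Θ))
          (sym (map-++ (map₂ f) (scale p Δ) (scale (1ℚ - p) Θ)))

  wsum-mapD : ∀ f (Δ : Dist {n}) g → wsum (mapD f Δ) g ≡ wsum Δ (λ s → g (f s))
  wsum-mapD f [] g = refl
  wsum-mapD f ((p , s) ∷ Δ) g = cong (p * g (f s) +_) (wsum-mapD f Δ g)

  wsum-cong : ∀ (Δ : Dist {n}) {f g} → (∀ s → f s ≡ g s) → wsum Δ f ≡ wsum Δ g
  wsum-cong [] f≗g = refl
  wsum-cong ((p , s) ∷ Δ) f≗g = cong₂ (λ a b → p * a + b) (f≗g s) (wsum-cong Δ f≗g)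

  delayω : Proc {n} → Proc {n}
  delayω nil = nil
  delayω (act a ∙ P) = act a ∙ delayω P
  delayω (ω ∙ P) = (ω ∙ P) ⊓ (ω ∙ P)
  delayω (X ⊓ Y) = delayω X ⊓ delayω Y
  delayω (X □ Y) = delayω X □ delayω Y
  delayω (⊕[ p , h₁ , h₂ ] X Y) = ⊕[ p , h₁ , h₂ ] (delayω X) (delayω Y)
  delayω (par X A Y) = par (delayω X) A (delayω Y)

  mutual
    undelayω : Proc {n} → Proc {n}
    undelayω nil = nil
    undelayω (π ∙ P) = π ∙ undelayω P
    undelayω (X ⊓ Y) = undelayω-⊓ X Y
    undelayω (X □ Y) = undelayω X □ undelayω Y
    undelayω (⊕[ p , h₁ , h₂ ] X Y) = ⊕[ p , h₁ , h₂ ] (undelayω X) (undelayω Y)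
    undelayω (par X A Y) = par (undelayω X) A (undelayω Y)

    undelayω-⊓ : Proc {n} → Proc {n} → Proc {n}
    undelayω-⊓ (ω ∙ R) Y = ω ∙ R
    undelayω-⊓ X Y = undelayω X ⊓ undelayω Y

  -- delayω never produces an ω-prefix, so the first clause of undelayω-⊓ does not fire.
  undelayω-⊓-delayω : ∀ X Y → undelayω-⊓ (delayω X) (delayω Y) ≡ undelayω (delayω X) ⊓ undelayω (delayω Y)
  undelayω-⊓-delayω nil Y = refl
  undelayω-⊓-delayω (act a ∙ X) Y = refl
  undelayω-⊓-delayω (ω ∙ X) Y = refl
  undelayω-⊓-delayω (X ⊓ X′) Y = refl
  undelayω-⊓-delayω (X □ X′) Y = refl
  undelayω-⊓-delayω (⊕[ p , h₁ , h₂ ] X X′) Y = refl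
  undelayω-⊓-delayω (par X A X′) Y = refl

  undelayω-delayω : ∀ s → undelayω (delayω s) ≡ s
  undelayω-delayω nil = refl
  undelayω-delayω (act a ∙ P) = cong (act a ∙_) (undelayω-delayω P)
  undelayω-delayω (ω ∙ P) = refl
  undelayω-delayω (X ⊓ Y) =
    trans (undelayω-⊓-delayω X Y) (cong₂ _⊓_ (undelayω-delayω X) (undelayω-delayω Y))
  undelayω-delayω (X □ Y) = cong₂ _□_ (undelayω-delayω X) (undelayω-delayω Y)
  undelayω-delayω (⊕[ p , h₁ , h₂ ] X Y) =
    cong₂ ⊕[ p , h₁ , h₂ ] (undelayω-delayω X) (undelayω-delayω Y)
  undelayω-delayω (par X A Y) = cong₂ (λ X Y → par X A Y) (undelayω-delayω X) (undelayω-delayω Y)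

  delayω-ωFree : ∀ {P} → ωFree P → delayω P ≡ P
  delayω-ωFree nil = refl
  delayω-ωFree (pre f) = cong (_ ∙_) (delayω-ωFree f)
  delayω-ωFree (int f g) = cong₂ _⊓_ (delayω-ωFree f) (delayω-ωFree g)
  delayω-ωFree (ext f g) = cong₂ _□_ (delayω-ωFree f) (delayω-ωFree g)
  delayω-ωFree (pch {p} {h₁ = h₁} {h₂ = h₂} f g) = cong₂ ⊕[ p , h₁ , h₂ ] (delayω-ωFree f) (delayω-ωFree g)
  delayω-ωFree (prl {A = A} f g) = cong₂ (λ X Y → par X A Y) (delayω-ωFree f) (delayω-ωFree g)

  delayω-lift□ : ∀ Δ Θ → lift₂ _□_ (mapD delayω Δ) (mapD delayω Θ) ≡ mapD delayω (lift₂ _□_ Δ Θ)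
  delayω-lift□ = lift₂-mapD _□_ delayω (λ _ _ → refl)

  delayω-lift∥ : ∀ A Δ Θ → lift₂ (λ s t → par s A t) (mapD delayω Δ) (mapD delayω Θ)
                         ≡ mapD delayω (lift₂ (λ s t → par s A t) Δ Θ)
  delayω-lift∥ A = lift₂-mapD (λ s t → par s A t) delayω (λ _ _ → refl)

  ⟦⟧-delayω : ∀ S → ⟦ delayω S ⟧ ≡ mapD delayω ⟦ S ⟧
  ⟦⟧-delayω nil = refl
  ⟦⟧-delayω (act a ∙ P) = refl
  ⟦⟧-delayω (ω ∙ P) = refl
  ⟦⟧-delayω (X ⊓ Y) = refl
  ⟦⟧-delayω (X □ Y) rewrite ⟦⟧-delayω X | ⟦⟧-delayω Y = delayω-lift□ ⟦ X ⟧ ⟦ Y ⟧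
  ⟦⟧-delayω (⊕[ p , _ , _ ] X Y) rewrite ⟦⟧-delayω X | ⟦⟧-delayω Y = pmix-mapD delayω p ⟦ X ⟧ ⟦ Y ⟧
  ⟦⟧-delayω (par X A Y) rewrite ⟦⟧-delayω X | ⟦⟧-delayω Y = delayω-lift∥ A ⟦ X ⟧ ⟦ Y ⟧

  ⟦⟧-delayω-test : ∀ T {P} → ωFree P → ⟦ par (delayω T) ActAll P ⟧ ≡ mapD delayω ⟦ par T ActAll P ⟧
  ⟦⟧-delayω-test T {P} ωFree-P =
    trans (cong (λ Q → ⟦ par (delayω T) ActAll Q ⟧) (sym (delayω-ωFree ωFree-P)))
          (⟦⟧-delayω (par T ActAll P))

  retarget : ∀ {s : Proc {n}} {α Δ Δ′} → Δ ≡ Δ′ → s —[ α ]→ Δ → s —[ α ]→ Δ′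
  retarget {s} {α} = subst (s —[ α ]→_)

  delayω-step : ∀ {s α Δ} → s —[ α ]→ Δ → α ≢ lω → delayω s —[ α ]→ mapD delayω Δ
  delayω-step (pre {act a} {P}) _ = retarget (⟦⟧-delayω P) pre
  delayω-step (pre {ω}) α≢ω = ⊥-elim (α≢ω refl)
  delayω-step (intL {P}) _ = retarget (⟦⟧-delayω P) intL
  delayω-step (intR {Q = Q}) _ = retarget (⟦⟧-delayω Q) intR
  delayω-step (extL α≢τ t) α≢ω = extL α≢τ (delayω-step t α≢ω)
  delayω-step (extR α≢τ t) α≢ω = extR α≢τ (delayω-step t α≢ω)
  delayω-step (extτL {s₂ = s₂} {Δ} t) α≢ω =
    retarget (delayω-lift□ Δ (point s₂)) (extτL (delayω-step t α≢ω))
  delayω-step (extτR {s₁ = s₁} {Δ = Δ} t) α≢ω =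
    retarget (delayω-lift□ (point s₁) Δ) (extτR (delayω-step t α≢ω))
  delayω-step (parL {s₂ = s₂} {A} {Δ = Δ} α∉A t) α≢ω =
    retarget (delayω-lift∥ A Δ (point s₂)) (parL α∉A (delayω-step t α≢ω))
  delayω-step (parR {s₁ = s₁} {A = A} {Δ = Δ} α∉A t) α≢ω =
    retarget (delayω-lift∥ A (point s₁) Δ) (parR α∉A (delayω-step t α≢ω))
  delayω-step (sync {A = A} {Δ₁ = Δ₁} {Δ₂} a∈A t₁ t₂) _ =
    retarget (delayω-lift∥ A Δ₁ Δ₂) (sync a∈A (delayω-step t₁ λ ()) (delayω-step t₂ λ ()))

  -- The label is passed as an equation because lω cannot be unified with pfxLabel π.
  delayω-ω-step : ∀ {s α Δ} → s —[ α ]→ Δ → α ≡ lω →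
                  ∃[ u ] ∃[ Θ ] (u —[ lω ]→ Θ × delayω s —[ τ ]→ point u)
  delayω-ω-step (pre {ω} {P}) _ = ω ∙ P , _ , pre , intL
  delayω-ω-step (pre {act a}) ()
  delayω-ω-step (extL {s₂ = s₂} _ t) refl with delayω-ω-step t refl
  ... | u , Θ , uω , τu = u □ delayω s₂ , Θ , extL (λ ()) uω , extτL τu
  delayω-ω-step (extR {s₁ = s₁} _ t) refl with delayω-ω-step t refl
  ... | u , Θ , uω , τu = delayω s₁ □ u , Θ , extR (λ ()) uω , extτR τu
  delayω-ω-step (parL {s₂ = s₂} {A} _ t) refl with delayω-ω-step t refl
  ... | u , Θ , uω , τu = par u A (delayω s₂) , _ , parL ω uω , parL τ τu
  delayω-ω-step (parR {s₁ = s₁} {A = A} _ t) refl with delayω-ω-step t refl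
  ... | u , Θ , uω , τu = par (delayω s₁) A u , _ , parR ω uω , parR τ τu

  data DelayedStep (s : Proc {n}) : Label {n} → Dist {n} → Set where
    undelayed : ∀ {α Δ Δ′} → s —[ α ]→ Δ → α ≢ lω → Δ′ ≡ mapD delayω Δ → DelayedStep s α Δ′
    ωGuard    : ∀ {u Θ Θ′} → s —[ lω ]→ Θ′ → u —[ lω ]→ Θ → DelayedStep s τ (point u)

  delayω-inv : ∀ s {α Δ′} → delayω s —[ α ]→ Δ′ → DelayedStep s α Δ′
  delayω-inv (act a ∙ P) pre = undelayed pre (λ ()) (⟦⟧-delayω P)
  delayω-inv (ω ∙ P) intL = ωGuard pre pre
  delayω-inv (ω ∙ P) intR = ωGuard pre pre
  delayω-inv (X ⊓ Y) intL = undelayed intL (λ ()) (⟦⟧-delayω X)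
  delayω-inv (X ⊓ Y) intR = undelayed intR (λ ()) (⟦⟧-delayω Y)
  delayω-inv (X □ Y) (extL α≢τ t) with delayω-inv X t
  ... | undelayed t′ α≢ω eq = undelayed (extL α≢τ t′) α≢ω eq
  ... | ωGuard _ _ = ⊥-elim (α≢τ refl)
  delayω-inv (X □ Y) (extR α≢τ t) with delayω-inv Y t
  ... | undelayed t′ α≢ω eq = undelayed (extR α≢τ t′) α≢ω eq
  ... | ωGuard _ _ = ⊥-elim (α≢τ refl)
  delayω-inv (X □ Y) (extτL t) with delayω-inv X t
  ... | undelayed {Δ = Δ} t′ α≢ω refl = undelayed (extτL t′) α≢ω (delayω-lift□ Δ (point Y))
  ... | ωGuard Xω uω = ωGuard (extL (λ ()) Xω) (extL (λ ()) uω)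
  delayω-inv (X □ Y) (extτR t) with delayω-inv Y t
  ... | undelayed {Δ = Δ} t′ α≢ω refl = undelayed (extτR t′) α≢ω (delayω-lift□ (point X) Δ)
  ... | ωGuard Yω uω = ωGuard (extR (λ ()) Yω) (extR (λ ()) uω)
  delayω-inv (par X A Y) (parL α∉A t) with delayω-inv X t
  ... | undelayed {Δ = Δ} t′ α≢ω refl = undelayed (parL α∉A t′) α≢ω (delayω-lift∥ A Δ (point Y))
  ... | ωGuard Xω uω = ωGuard (parL ω Xω) (parL ω uω)
  delayω-inv (par X A Y) (parR α∉A t) with delayω-inv Y t
  ... | undelayed {Δ = Δ} t′ α≢ω refl = undelayed (parR α∉A t′) α≢ω (delayω-lift∥ A (point X) Δ)
  ... | ωGuard Yω uω = ωGuard (parR ω Yω) (parR ω uω)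
  delayω-inv (par X A Y) (sync a∈A t₁ t₂) with delayω-inv X t₁ | delayω-inv Y t₂
  ... | undelayed {Δ = Δ₁} t₁′ _ refl | undelayed {Δ = Δ₂} t₂′ _ refl =
    undelayed (sync a∈A t₁′ t₂′) (λ ()) (delayω-lift∥ A Δ₁ Δ₂)

  delayω-¬ω : ∀ s → ¬ (∃[ Θ ] (delayω s —[ lω ]→ Θ))
  delayω-¬ω s (Θ , t) with delayω-inv s t
  ... | undelayed _ α≢ω _ = α≢ω refl

  delayω-stuck : ∀ {s} → Stuck s → Stuck (delayω s)
  delayω-stuck {s} stuck-s α Δ t with delayω-inv s t
  ... | undelayed t′ _ _ = stuck-s _ _ t′
  ... | ωGuard sω _ = stuck-s _ _ sω

  stuck-delayω : ∀ {s : Proc {n}} → Stuck (delayω s) → Stuck s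
  stuck-delayω stuck-ds lω Δ t with delayω-ω-step t refl
  ... | _ , _ , _ , τu = stuck-ds _ _ τu
  stuck-delayω stuck-ds τ Δ t = stuck-ds _ _ (delayω-step t λ ())
  stuck-delayω stuck-ds (lac a) Δ t = stuck-ds _ _ (delayω-step t λ ())

  V-ω⇒≡1 : ∀ {u : Proc {n}} {Θ x} → u —[ lω ]→ Θ → V u x → x ≡ 1ℚ
  V-ω⇒≡1 uω (succ _) = refl
  V-ω⇒≡1 uω (step ¬ω _ _) = ⊥-elim (¬ω (_ , uω))
  V-ω⇒≡1 uω (stuck stuck-u) = ⊥-elim (stuck-u _ _ uω)

  VD-point-ω⇒≡1 : ∀ {u : Proc {n}} {Θ x} → u —[ lω ]→ Θ → VD (point u) x → x ≡ 1ℚ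
  VD-point-ω⇒≡1 uω (mk f (v ∷ []) x≡) rewrite V-ω⇒≡1 uω v = x≡

  mutual
    V̄⇒V-delayω : ∀ s {x} → V̄ s x → V (delayω s) x
    V̄⇒V-delayω s (succ sω) with delayω-ω-step sω refl
    ... | u , _ , uω , τu = step (delayω-¬ω s) τu (mk (λ _ → 1ℚ) (succ uω ∷ []) refl)
    V̄⇒V-delayω s (step t α≢ω vd) = step (delayω-¬ω s) (delayω-step t α≢ω) (V̄D⇒VD-delayω _ vd)
    V̄⇒V-delayω s (stuck stuck-s) = stuck (delayω-stuck stuck-s)

    -- A result function f on Δ is transported along delayω through its left inverse.
    V̄D⇒VD-delayω : ∀ Δ {x} → V̄D Δ x → VD (mapD delayω Δ) x
    V̄D⇒VD-delayω Δ (mk f vs x≡) =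
      mk (λ s → f (undelayω s)) (All-V̄⇒All-V-delayω Δ f vs)
         (trans x≡ (sym (trans (wsum-mapD delayω Δ _) (wsum-cong Δ λ s → cong f (undelayω-delayω s)))))

    All-V̄⇒All-V-delayω : ∀ Δ f → All (λ ps → V̄ (proj₂ ps) (f (proj₂ ps))) Δ →
                           All (λ ps → V (proj₂ ps) (f (undelayω (proj₂ ps)))) (mapD delayω Δ)
    All-V̄⇒All-V-delayω [] f [] = []
    All-V̄⇒All-V-delayω ((p , s) ∷ Δ) f (v ∷ vs) =
      subst (V (delayω s)) (cong f (sym (undelayω-delayω s))) (V̄⇒V-delayω s v)
      ∷ All-V̄⇒All-V-delayω Δ f vs

  mutual
    V-delayω⇒V̄ : ∀ s {x} → V (delayω s) x → V̄ s x
    V-delayω⇒V̄ s (succ t) = ⊥-elim (delayω-¬ω s (_ , t))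
    V-delayω⇒V̄ s (step _ t vd) with delayω-inv s t
    ... | undelayed t′ α≢ω refl = step t′ α≢ω (VD-delayω⇒V̄D _ vd)
    ... | ωGuard sω uω = subst (V̄ s) (sym (VD-point-ω⇒≡1 uω vd)) (succ sω)
    V-delayω⇒V̄ s (stuck stuck-ds) = stuck (stuck-delayω stuck-ds)

    VD-delayω⇒V̄D : ∀ Δ {x} → VD (mapD delayω Δ) x → V̄D Δ x
    VD-delayω⇒V̄D Δ (mk f vs x≡) =
      mk (λ s → f (delayω s)) (All-V-delayω⇒All-V̄ Δ f vs) (trans x≡ (wsum-mapD delayω Δ f))

    All-V-delayω⇒All-V̄ : ∀ Δ f → All (λ ps → V (proj₂ ps) (f (proj₂ ps))) (mapD delayω Δ) →
                           All (λ ps → V̄ (proj₂ ps) (f (delayω (proj₂ ps)))) Δ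
    All-V-delayω⇒All-V̄ [] f [] = []
    All-V-delayω⇒All-V̄ ((p , s) ∷ Δ) f (v ∷ vs) = V-delayω⇒V̄ s v ∷ All-V-delayω⇒All-V̄ Δ f vs

  𝒜̄⇒𝒜-delayω : ∀ T {P} → ωFree P → ∀ {x} → 𝒜̄ T P x → 𝒜 (delayω T) P x
  𝒜̄⇒𝒜-delayω T ωFree-P {x} a =
    subst (λ Δ → VD Δ x) (sym (⟦⟧-delayω-test T ωFree-P)) (V̄D⇒VD-delayω _ a)

  𝒜-delayω⇒𝒜̄ : ∀ T {P} → ωFree P → ∀ {x} → 𝒜 (delayω T) P x → 𝒜̄ T P x
  𝒜-delayω⇒𝒜̄ T ωFree-P {x} a =
    VD-delayω⇒V̄D _ (subst (λ Δ → VD Δ x) (⟦⟧-delayω-test T ωFree-P) a)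

proposition5p1 : ∀ {n : ℕ} (P Q : Proc {n}) → ωFree P → ωFree Q →
    ((P ⊑pmay Q → P ⊑̄pmay Q) × (P ⊑pmust Q → P ⊑̄pmust Q))
proposition5p1 P Q ωFree-P ωFree-Q = may , must
  where
  may : P ⊑pmay Q → P ⊑̄pmay Q
  may P⊑Q T x x∈ =
    let (y , y∈ , x≤y) = P⊑Q (delayω T) x (𝒜̄⇒𝒜-delayω T ωFree-P x∈)
    in y , 𝒜-delayω⇒𝒜̄ T ωFree-Q y∈ , x≤y

  must : P ⊑pmust Q → P ⊑̄pmust Q
  must P⊑Q T y y∈ =
    let (x , x∈ , x≤y) = P⊑Q (delayω T) y (𝒜̄⇒𝒜-delayω T ωFree-Q y∈)
    in x , 𝒜-delayω⇒𝒜̄ T ωFree-P x∈ , x≤y
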